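{- For every integer $n\ge 0$, the $n$th Catalan number $C_n=\frac{1}{n+1}\binom{2n}{n}$ satisfies $$C_n=\frac{1}{3n+2}\binom{2n,\,1}{n,\,2}.$$
   Context: For a nonnegative integer $m$ and positive integers $n,q$, let $X$ be a set which is the disjoint union of $n$ "main blocks" each of size $q$ and an "additional block" of size $m$. An $(n+k)$-inset of $X$ is an $(n+k)$-element subset of $X$ that intersects every main block; their number is denoted $\binom{m,n}{k,q}$. Thus $\binom{2n,1}{n,2}$ is the number of $(n+1)$-subsets of a set consisting of a $2$-element main block and a $2n$-element additional block which meet the main block. -}

module Defs where

open import Data.Nat using (ℕ; zero; suc; _+_; _*_)
open import Data.Nat.DivMod using (_/_)
open import Data.Nat.Combinatorics using (_C_)
open import Data.Bool using (Bool; true; false; _∨_; _∧_; if_then_else_)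
open import Data.Vec using (Vec; []; _∷_; foldr)
open import Data.List using (List; []; _∷_; map; concatMap; filter; length; _++_)
open import Data.Product using (_×_; _,_)
open import Relation.Nullary using (Dec; yes; no)
open import Relation.Nullary.Decidable using (_×-dec_)
open import Relation.Binary.PropositionalEquality using (_≡_)
open import Data.Bool.Properties using () renaming (_≟_ to _≟ᵇ_)
open import Data.Nat.Properties using (_≟_)

-- A subset of a finite N-element block is a characteristic vector Vec Bool N.
-- All subsets of an N-element set, as a list (each exactly once).
allSubsets : (N : ℕ) → List (Vec Bool N)
allSubsets zero    = [] ∷ []
allSubsets (suc N) = concatMap (λ s → (false ∷ s) ∷ (true ∷ s) ∷ []) (allSubsets N)

card : {N : ℕ} → Vec Bool N → ℕ
card []           = 0
card (true ∷ s)  = suc (card s)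
card (false ∷ s) = card s

nonempty : {N : ℕ} → Vec Bool N → Bool
nonempty = foldr _ _∨_ false

-- A subset of X = (n main blocks of size q) ⊔ (additional block of size m)
-- is a pair: for each main block its subset, and the subset of the additional block.
SubsetX : (m n q : ℕ) → Set
SubsetX m n q = Vec (Vec Bool q) n × Vec Bool m

allVecs : {A : Set} → List A → (n : ℕ) → List (Vec A n)
allVecs xs zero    = [] ∷ []
allVecs xs (suc n) = concatMap (λ x → map (x ∷_) (allVecs xs n)) xs

allSubsetsX : (m n q : ℕ) → List (SubsetX m n q)
allSubsetsX m n q = concatMap (λ bs → map (bs ,_) (allSubsets m)) (allVecs (allSubsets q) n)

cardX : {m n q : ℕ} → SubsetX m n q → ℕ
cardX (bs , a) = foldr _ (λ b r → card b + r) 0 bs + card a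

meetsAllMain : {m n q : ℕ} → SubsetX m n q → Bool
meetsAllMain (bs , a) = foldr _ (λ b r → nonempty b ∧ r) true bs

isInset? : (m n k q : ℕ) (S : SubsetX m n q) → Dec ((cardX S ≡ n + k) × (meetsAllMain S ≡ true))
isInset? m n k q S = (cardX S ≟ n + k) ×-dec (meetsAllMain S ≟ᵇ true)

-- the number of (n+k)-insets:  binom(m,n ; k,q)
insets : (m n k q : ℕ) → ℕ
insets m n k q = length (filter (isInset? m n k q) (allSubsetsX m n q))

catalan : ℕ → ℕ
catalan n = ((2 * n) C n) / suc n

-- Split the (n+1)-insets by their trace on the two-element main block: one
-- element there (two ways) leaves an n-subset of the additional block, both
-- elements leave an (n-1)-subset, so the count is 2·C(2n,n) + C(2n,n-1).
-- Absorption gives n·C(2n,n) = (n+1)·C(2n,n-1), hence C(2n,n) = (n+1)·C_n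
-- and C(2n,n-1) = n·C_n with C_n = C(2n,n) − C(2n,n-1); the total is (3n+2)·C_n.
module Submission where

open import Defs
open import Data.Nat using (ℕ; zero; suc; _+_; _*_; _∸_; _≤_)
open import Data.Nat.Properties
open import Data.Nat.DivMod using (_/_; m*n/n≡m)
open import Data.Nat.Combinatorics using (_C_; nC1≡n; nCk+nC[k+1]≡[n+1]C[k+1])
open import Data.Nat.ListAction using (sum)
open import Data.Nat.Tactic.RingSolver using (solve-∀)
open import Data.Bool using (Bool; true; false)
open import Data.Vec using (Vec; []; _∷_)
open import Data.List using (List; []; _∷_; map; concatMap; filter; length; _++_)
open import Data.List.Properties using (length-++; filter-++; filter-none; filter-≐)
open import Data.List.Relation.Unary.All using (universal)
open import Data.Product using (_×_; _,_; proj₁)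
open import Algebra.Properties.CommutativeSemigroup +-commutativeSemigroup using (interchange)
open import Function using (_∘_)
open import Relation.Nullary using (¬_; yes; no)
open import Relation.Unary using (Pred; Decidable; _≐_)
open import Relation.Binary.PropositionalEquality using (_≡_; refl; sym; trans; cong; cong₂; module ≡-Reasoning)

module _ {a p} {A : Set a} {P : Pred A p} (P? : Decidable P) where

  length-filter-++ : ∀ xs ys →
                     length (filter P? (xs ++ ys)) ≡ length (filter P? xs) + length (filter P? ys)
  length-filter-++ xs ys = trans (cong length (filter-++ P? xs ys)) (length-++ (filter P? xs))

  length-filter-none : (∀ x → ¬ P x) → ∀ xs → length (filter P? xs) ≡ 0
  length-filter-none ¬P xs = cong length (filter-none P? (universal ¬P xs))

  length-filter-map : ∀ {b} {B : Set b} (f : B → A) xs →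
                      length (filter P? (map f xs)) ≡ length (filter (P? ∘ f) xs)
  length-filter-map f [] = refl
  length-filter-map f (x ∷ xs) with P? (f x)
  ... | yes _ = cong suc (length-filter-map f xs)
  ... | no _  = length-filter-map f xs

  length-filter-concatMap : ∀ {b} {B : Set b} (f : B → List A) xs →
                            length (filter P? (concatMap f xs)) ≡ sum (map (length ∘ filter P? ∘ f) xs)
  length-filter-concatMap f []       = refl
  length-filter-concatMap f (x ∷ xs) =
    trans (length-filter-++ (f x) (concatMap f xs)) (cong (length (filter P? (f x)) +_) (length-filter-concatMap f xs))

  length-filter-interleave : ∀ {b} {B : Set b} (f g : B → A) xs →
                             length (filter P? (concatMap (λ x → f x ∷ g x ∷ []) xs)) ≡
                             length (filter P? (map f xs)) + length (filter P? (map g xs))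
  length-filter-interleave f g []       = refl
  length-filter-interleave f g (x ∷ xs) = begin
    length (filter P? ((f x ∷ []) ++ ((g x ∷ []) ++ rest)))
      ≡⟨ length-filter-++ (f x ∷ []) _ ⟩
    ♯ (f x ∷ []) + length (filter P? ((g x ∷ []) ++ rest))
      ≡⟨ cong (♯ (f x ∷ []) +_) (length-filter-++ (g x ∷ []) rest) ⟩
    ♯ (f x ∷ []) + (♯ (g x ∷ []) + length (filter P? rest))
      ≡⟨ cong (λ r → ♯ (f x ∷ []) + (♯ (g x ∷ []) + r)) (length-filter-interleave f g xs) ⟩
    ♯ (f x ∷ []) + (♯ (g x ∷ []) + (♯ (map f xs) + ♯ (map g xs)))
      ≡⟨ +-assoc (♯ (f x ∷ [])) _ _ ⟨
    (♯ (f x ∷ []) + ♯ (g x ∷ [])) + (♯ (map f xs) + ♯ (map g xs))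
      ≡⟨ interchange (♯ (f x ∷ [])) _ _ _ ⟩
    (♯ (f x ∷ []) + ♯ (map f xs)) + (♯ (g x ∷ []) + ♯ (map g xs))
      ≡⟨ cong₂ _+_ (length-filter-++ (f x ∷ []) (map f xs)) (length-filter-++ (g x ∷ []) (map g xs)) ⟨
    ♯ (map f (x ∷ xs)) + ♯ (map g (x ∷ xs)) ∎
    where
    open ≡-Reasoning
    rest = concatMap (λ x → f x ∷ g x ∷ []) xs
    ♯ : List A → ℕ
    ♯ = length ∘ filter P?

length-filter-≐ : ∀ {a p q} {A : Set a} {P : Pred A p} {Q : Pred A q}
                  (P? : Decidable P) (Q? : Decidable Q) → P ≐ Q →
                  ∀ xs → length (filter P? xs) ≡ length (filter Q? xs)
length-filter-≐ P? Q? P≐Q xs = cong length (filter-≐ P? Q? P≐Q xs)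

card≟ : ∀ {N} k → Decidable (λ (s : Vec Bool N) → card s ≡ k)
card≟ k s = card s ≟ k

length-filter-card-allSubsets : ∀ m k → length (filter (card≟ k) (allSubsets m)) ≡ m C k
length-filter-card-allSubsets zero    zero    = refl
length-filter-card-allSubsets zero    (suc k) = refl
length-filter-card-allSubsets (suc m) zero    = begin
  length (filter (card≟ 0) (allSubsets (suc m)))
    ≡⟨ length-filter-interleave (card≟ 0) (false ∷_) (true ∷_) (allSubsets m) ⟩
  length (filter (card≟ 0) (map (false ∷_) S)) + length (filter (card≟ 0) (map (true ∷_) S))
    ≡⟨ cong₂ _+_ (length-filter-map (card≟ 0) (false ∷_) S)
                 (trans (length-filter-map (card≟ 0) (true ∷_) S)
                        (length-filter-none (card≟ 0 ∘ (true ∷_)) (λ _ ()) S)) ⟩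
  length (filter (card≟ 0) S) + 0
    ≡⟨ cong (_+ 0) (length-filter-card-allSubsets m zero) ⟩
  suc m C 0 ∎
  where open ≡-Reasoning; S = allSubsets m
length-filter-card-allSubsets (suc m) (suc k) = begin
  length (filter (card≟ (suc k)) (allSubsets (suc m)))
    ≡⟨ length-filter-interleave (card≟ (suc k)) (false ∷_) (true ∷_) S ⟩
  length (filter (card≟ (suc k)) (map (false ∷_) S)) + length (filter (card≟ (suc k)) (map (true ∷_) S))
    ≡⟨ cong₂ _+_ (length-filter-map (card≟ (suc k)) (false ∷_) S)
                 (trans (length-filter-map (card≟ (suc k)) (true ∷_) S)
                        (length-filter-≐ (card≟ (suc k) ∘ (true ∷_)) (card≟ k) (suc-injective , cong suc) S)) ⟩
  length (filter (card≟ (suc k)) S) + length (filter (card≟ k) S)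
    ≡⟨ cong₂ _+_ (length-filter-card-allSubsets m (suc k)) (length-filter-card-allSubsets m k) ⟩
  m C suc k + m C k
    ≡⟨ +-comm (m C suc k) (m C k) ⟩
  m C k + m C suc k
    ≡⟨ nCk+nC[k+1]≡[n+1]C[k+1] m k ⟩
  suc m C suc k ∎
  where open ≡-Reasoning; S = allSubsets m

[k+1]*nC[k+1]+k*nCk≡n*nCk : ∀ n k → suc k * (n C suc k) + k * (n C k) ≡ n * (n C k)
[k+1]*nC[k+1]+k*nCk≡n*nCk zero    zero    = refl
[k+1]*nC[k+1]+k*nCk≡n*nCk zero    (suc k) = cong₂ _+_ (*-zeroʳ (2 + k)) (*-zeroʳ (suc k))
[k+1]*nC[k+1]+k*nCk≡n*nCk (suc n) zero    =
  trans (+-identityʳ (1 * (suc n C 1))) (trans (*-identityˡ (suc n C 1)) (trans (nC1≡n (suc n)) (sym (*-identityʳ (suc n)))))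
[k+1]*nC[k+1]+k*nCk≡n*nCk (suc n) (suc k) = begin
  (2 + k) * (suc n C (2 + k)) + (1 + k) * (suc n C suc k)
    ≡⟨ cong₂ (λ u v → (2 + k) * u + (1 + k) * v)
             (nCk+nC[k+1]≡[n+1]C[k+1] n (suc k)) (nCk+nC[k+1]≡[n+1]C[k+1] n k) ⟨
  (2 + k) * (c₁ + c₂) + (1 + k) * (c₀ + c₁)
    ≡⟨ regroup k c₀ c₁ c₂ ⟩
  ((2 + k) * c₂ + (1 + k) * c₁) + c₁ + ((1 + k) * c₁ + k * c₀) + c₀
    ≡⟨ cong₂ (λ u v → u + c₁ + v + c₀)
             ([k+1]*nC[k+1]+k*nCk≡n*nCk n (suc k)) ([k+1]*nC[k+1]+k*nCk≡n*nCk n k) ⟩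
  n * c₁ + c₁ + n * c₀ + c₀
    ≡⟨ collect n c₀ c₁ ⟩
  (1 + n) * (c₀ + c₁)
    ≡⟨ cong ((1 + n) *_) (nCk+nC[k+1]≡[n+1]C[k+1] n k) ⟩
  suc n * (suc n C suc k) ∎
  where
  open ≡-Reasoning
  c₀ = n C k
  c₁ = n C suc k
  c₂ = n C (2 + k)
  regroup : ∀ k c₀ c₁ c₂ → (2 + k) * (c₁ + c₂) + (1 + k) * (c₀ + c₁) ≡
                           ((2 + k) * c₂ + (1 + k) * c₁) + c₁ + ((1 + k) * c₁ + k * c₀) + c₀
  regroup = solve-∀
  collect : ∀ n c₀ c₁ → n * c₁ + c₁ + n * c₀ + c₀ ≡ (1 + n) * (c₀ + c₁)
  collect = solve-∀

[n+1]*[2n+2]C[n+1]≡[n+2]*[2n+2]Cn : ∀ n → suc n * (2 * suc n C suc n) ≡ (2 + n) * (2 * suc n C n)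
[n+1]*[2n+2]C[n+1]≡[n+2]*[2n+2]Cn n = +-cancelʳ-≡ (n * b) _ _ (begin
  suc n * a + n * b     ≡⟨ [k+1]*nC[k+1]+k*nCk≡n*nCk (2 * suc n) n ⟩
  2 * suc n * b         ≡⟨ split n b ⟩
  (2 + n) * b + n * b   ∎)
  where
  open ≡-Reasoning
  a = 2 * suc n C suc n
  b = 2 * suc n C n
  split : ∀ n b → 2 * suc n * b ≡ (2 + n) * b + n * b
  split = solve-∀

module _ {k a b : ℕ} (k*a≡[1+k]*b : k * a ≡ suc k * b) where

  k*a≡[1+k]*b⇒b≤a : b ≤ a
  k*a≡[1+k]*b⇒b≤a = *-cancelˡ-≤ (suc k) (begin
    suc k * b ≡⟨ k*a≡[1+k]*b ⟨
    k * a     ≤⟨ *-monoˡ-≤ a (n≤1+n k) ⟩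
    suc k * a ∎)
    where open ≤-Reasoning

  k*a≡[1+k]*b⇒b≡k*[a∸b] : b ≡ k * (a ∸ b)
  k*a≡[1+k]*b⇒b≡k*[a∸b] = begin
    b                 ≡⟨ m+n∸n≡m b (k * b) ⟨
    b + k * b ∸ k * b ≡⟨ cong (_∸ k * b) k*a≡[1+k]*b ⟨
    k * a ∸ k * b     ≡⟨ *-distribˡ-∸ k a b ⟨
    k * (a ∸ b)       ∎
    where open ≡-Reasoning

  k*a≡[1+k]*b⇒a≡[1+k]*[a∸b] : a ≡ suc k * (a ∸ b)
  k*a≡[1+k]*b⇒a≡[1+k]*[a∸b] = begin
    a                     ≡⟨ m∸n+n≡m k*a≡[1+k]*b⇒b≤a ⟨
    (a ∸ b) + b           ≡⟨ cong ((a ∸ b) +_) k*a≡[1+k]*b⇒b≡k*[a∸b] ⟩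
    (a ∸ b) + k * (a ∸ b) ∎
    where open ≡-Reasoning

module _ (n : ℕ) where

  private
    a b : ℕ
    a = 2 * suc n C suc n
    b = 2 * suc n C n

    balance : suc n * a ≡ suc (suc n) * b
    balance = [n+1]*[2n+2]C[n+1]≡[n+2]*[2n+2]Cn n

  catalan[n+1]≡[2n+2]C[n+1]∸[2n+2]Cn : catalan (suc n) ≡ 2 * suc n C suc n ∸ 2 * suc n C n
  catalan[n+1]≡[2n+2]C[n+1]∸[2n+2]Cn = begin
    a / suc (suc n)                     ≡⟨ cong (_/ suc (suc n)) (k*a≡[1+k]*b⇒a≡[1+k]*[a∸b] {suc n} {a} {b} balance) ⟩
    suc (suc n) * (a ∸ b) / suc (suc n) ≡⟨ cong (_/ suc (suc n)) (*-comm (suc (suc n)) (a ∸ b)) ⟩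
    (a ∸ b) * suc (suc n) / suc (suc n) ≡⟨ m*n/n≡m (a ∸ b) (suc (suc n)) ⟩
    a ∸ b                               ∎
    where open ≡-Reasoning

  [2n+2]C[n+1]≡[n+2]*catalan[n+1] : 2 * suc n C suc n ≡ suc (suc n) * catalan (suc n)
  [2n+2]C[n+1]≡[n+2]*catalan[n+1] = trans (k*a≡[1+k]*b⇒a≡[1+k]*[a∸b] {suc n} {a} {b} balance)
                                          (cong (suc (suc n) *_) (sym catalan[n+1]≡[2n+2]C[n+1]∸[2n+2]Cn))

  [2n+2]Cn≡[n+1]*catalan[n+1] : 2 * suc n C n ≡ suc n * catalan (suc n)
  [2n+2]Cn≡[n+1]*catalan[n+1] = trans (k*a≡[1+k]*b⇒b≡k*[a∸b] {suc n} {a} {b} balance)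
                                      (cong (suc n *_) (sym catalan[n+1]≡[2n+2]C[n+1]∸[2n+2]Cn))

insets-one-pair : ∀ m j → insets m 1 (suc j) 2 ≡ m C suc j + (m C suc j + m C j)
insets-one-pair m j = begin
  insets m 1 (suc j) 2
    ≡⟨ length-filter-concatMap P? (λ v → map (v ,_) S) (allVecs (allSubsets 2) 1) ⟩
  with-main (f ∷ f ∷ []) + (with-main (t ∷ f ∷ []) + (with-main (f ∷ t ∷ []) + (with-main (t ∷ t ∷ []) + 0)))
    ≡⟨ cong₂ _+_ none (cong₂ _+_ (with-main≡ (t ∷ f ∷ []) (suc j) one)
                                 (cong₂ _+_ (with-main≡ (f ∷ t ∷ []) (suc j) one′) (+-identityʳ _))) ⟩
  m C suc j + (m C suc j + with-main (t ∷ t ∷ []))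
    ≡⟨ cong (λ x → m C suc j + (m C suc j + x)) (with-main≡ (t ∷ t ∷ []) j both) ⟩
  m C suc j + (m C suc j + m C j) ∎
  where
  open ≡-Reasoning
  f = false
  t = true
  S = allSubsets m
  P? = isInset? m 1 (suc j) 2
  Inset : Vec Bool 2 → Vec Bool m → Set
  Inset v s = (cardX ((v ∷ []) , s) ≡ 1 + suc j) × (meetsAllMain ((v ∷ []) , s) ≡ true)
  with-main : Vec Bool 2 → ℕ
  with-main v = length (filter P? (map ((v ∷ []) ,_) S))
  with-main≡ : ∀ v k → Inset v ≐ (λ s → card s ≡ k) → with-main v ≡ m C k
  with-main≡ v k eq = begin
    with-main v                                      ≡⟨ length-filter-map P? ((v ∷ []) ,_) S ⟩
    length (filter (P? ∘ ((v ∷ []) ,_)) S)           ≡⟨ length-filter-≐ (P? ∘ ((v ∷ []) ,_)) (card≟ k) eq S ⟩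
    length (filter (card≟ k) S)                      ≡⟨ length-filter-card-allSubsets m k ⟩
    m C k                                            ∎
  none : with-main (f ∷ f ∷ []) ≡ 0
  none = trans (length-filter-map P? (((f ∷ f ∷ []) ∷ []) ,_) S) (length-filter-none (P? ∘ (((f ∷ f ∷ []) ∷ []) ,_)) (λ { _ (_ , ()) }) S)
  one : Inset (t ∷ f ∷ []) ≐ (λ s → card s ≡ suc j)
  one = suc-injective ∘ proj₁ , λ e → cong suc e , refl
  one′ : Inset (f ∷ t ∷ []) ≐ (λ s → card s ≡ suc j)
  one′ = suc-injective ∘ proj₁ , λ e → cong suc e , refl
  both : Inset (t ∷ t ∷ []) ≐ (λ s → card s ≡ j)
  both = suc-injective ∘ suc-injective ∘ proj₁ , λ e → cong (suc ∘ suc) e , refl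

mainTheorem12 : (n : ℕ) → (3 * n + 2) * catalan n ≡ insets (2 * n) 1 n 2
mainTheorem12 zero    = refl
mainTheorem12 (suc n) = begin
  (3 * suc n + 2) * c
    ≡⟨ split n c ⟩
  suc (suc n) * c + (suc (suc n) * c + suc n * c)
    ≡⟨ cong₂ (λ x y → x + (x + y)) ([2n+2]C[n+1]≡[n+2]*catalan[n+1] n) ([2n+2]Cn≡[n+1]*catalan[n+1] n) ⟨
  2 * suc n C suc n + (2 * suc n C suc n + 2 * suc n C n)
    ≡⟨ insets-one-pair (2 * suc n) n ⟨
  insets (2 * suc n) 1 (suc n) 2 ∎
  where
  open ≡-Reasoning
  c = catalan (suc n)
  split : ∀ n c → (3 * suc n + 2) * c ≡ suc (suc n) * c + (suc (suc n) * c + suc n * c)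
  split = solve-∀
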